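{- There exists a retraceable set $A$ such that no infinite subset $B\subseteq A$ is uniformly majorreducible.
   Context: An infinite set $A=\{a_0<a_1<\cdots\}$ is retraceable if there is a partial computable $\varphi$ with $\varphi(a_{n+1})=a_n$ for all $n$ and $\varphi(a_0)=a_0$. For an infinite set $B$ with principal function $p_B$ ($p_B(n)$ the $n$-th element of $B$ in increasing order), $B$ is uniformly majorreducible if there is a single Turing functional $\Phi$ with $\Phi^{f}=B$ for every function $f$ with $f(n)\ge p_B(n)$ for all $n$ (oracle the graph of $f$). -}

module Defs where

open import Data.Nat using (ℕ; zero; suc; _≤_; _<_; _≟_)
open import Data.Fin using (Fin)
open import Data.Vec using (Vec; []; _∷_; lookup)
open import Data.Bool using (Bool; true; false; if_then_else_)
open import Data.Maybe using (Maybe; just; nothing)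
open import Data.Product using (Σ; _×_; ∃)
open import Relation.Binary.PropositionalEquality using (_≡_)
open import Relation.Nullary.Decidable using (⌊_⌋)

-- Oracle μ-recursive functions (a standard model of relative computation).
-- An oracle is a binary 0/1-valued predicate; the oracle for the GRAPH of
-- a function f answers "f n ≡ m ?".

Oracle : Set
Oracle = ℕ → ℕ → Bool

data Code : ℕ → Set where
  zer  : ∀ {n} → Code n
  succ : Code 1
  proj : ∀ {n} → Fin n → Code n
  comp : ∀ {n m} → Code m → Vec (Code n) m → Code n
  prec : ∀ {n} → Code n → Code (suc (suc n)) → Code (suc n)
  mu   : ∀ {n} → Code (suc n) → Code n
  orc  : Code 2

bit : Bool → ℕ
bit true  = 1
bit false = 0

-- fuel-bounded evaluation; nothing = not (yet) converged
mutual
  eval : ℕ → Oracle → ∀ {n} → Code n → Vec ℕ n → Maybe ℕ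
  eval zero    O c          xs = nothing
  eval (suc k) O zer        xs = just 0
  eval (suc k) O succ       (x ∷ []) = just (suc x)
  eval (suc k) O (proj i)   xs = just (lookup xs i)
  eval (suc k) O (comp g hs) xs with evalVec k O hs xs
  ... | just ys = eval k O g ys
  ... | nothing = nothing
  eval (suc k) O (prec g h) (zero ∷ xs) = eval k O g xs
  eval (suc k) O (prec g h) (suc y ∷ xs) with eval k O (prec g h) (y ∷ xs)
  ... | just r  = eval k O h (y ∷ r ∷ xs)
  ... | nothing = nothing
  eval (suc k) O (mu g)     xs = search k O g xs 0
  eval (suc k) O orc        (x ∷ y ∷ []) = just (bit (O x y))

  evalVec : ℕ → Oracle → ∀ {n m} → Vec (Code n) m → Vec ℕ n → Maybe (Vec ℕ m)
  evalVec k O []       xs = just []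
  evalVec k O (h ∷ hs) xs with eval k O h xs | evalVec k O hs xs
  ... | just y | just ys = just (y ∷ ys)
  ... | _      | _       = nothing

  search : ℕ → Oracle → ∀ {n} → Code (suc n) → Vec ℕ n → ℕ → Maybe ℕ
  search zero    O g xs i = nothing
  search (suc k) O g xs i with eval k O g (i ∷ xs)
  ... | just zero    = just i
  ... | just (suc _) = search k O g xs (suc i)
  ... | nothing      = nothing

_⟨_⟩_↓_ : Code 1 → Oracle → ℕ → ℕ → Set
Φ ⟨ O ⟩ x ↓ y = ∃ λ k → eval k O Φ (x ∷ []) ≡ just y

-- the empty oracle: unrelativised (partial computable) functions
noOracle : Oracle
noOracle _ _ = false

_·_↓_ : Code 1 → ℕ → ℕ → Set
φ · x ↓ y = φ ⟨ noOracle ⟩ x ↓ y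

graph : (ℕ → ℕ) → Oracle
graph f n m = ⌊ f n ≟ m ⌋

NSet : Set
NSet = ℕ → Bool

_⊆_ : NSet → NSet → Set
B ⊆ A = ∀ x → B x ≡ true → A x ≡ true

Infinite : NSet → Set
Infinite A = ∀ n → ∃ λ m → n ≤ m × A m ≡ true

IsPrincipal : NSet → (ℕ → ℕ) → Set
IsPrincipal A p = (∀ n → p n < p (suc n))
                × (∀ x → (A x ≡ true → ∃ λ n → p n ≡ x) × (∀ n → p n ≡ x → A x ≡ true))

Retraceable : NSet → Set
Retraceable A = Infinite A × Σ (Code 1) λ φ → ∀ p → IsPrincipal A p →
                  (φ · p 0 ↓ p 0) × (∀ n → φ · p (suc n) ↓ p n)

UniformlyMajorreducible : NSet → Set
UniformlyMajorreducible B = Infinite B × Σ (Code 1) λ Φ → ∀ p → IsPrincipal B p →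
  ∀ (f : ℕ → ℕ) → (∀ n → p n ≤ f n) →
  ∀ x → Φ ⟨ graph f ⟩ x ↓ (if B x then 1 else 0)

-- A is a branch a₀ < a₁ < ⋯ through the tree of binary expansions: a₀ = 0, a₁ = 1 and
-- a_{e+2} ∈ {2y, 2y+1} for y = a_{e+1}, so that ⌊_/2⌋ retraces A. Stage e diagonalises against
-- the code Φ numbered e: the branch turns to 2y+1 exactly when Φ uniformly majorreduces some
-- infinite set with an element below 2y in the tree (a decision taken by excluded middle).
-- A uniform majorreduction determines its set, since the pointwise maximum of two principal
-- functions majorizes both. So if Φ uniformly majorreduced an infinite B ⊆ A, either the branch
-- turned to 2y+1, and then B has an element below 2y although A has none; or it went to 2y,
-- and then the elements of B beyond a_{e+2} = 2y lie below 2y, so the branch should have turned.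

module Submission where

open import Defs
open import Level using (0ℓ)
open import Axiom.ExcludedMiddle using (ExcludedMiddle)
open import Data.Bool using (Bool; true; false; if_then_else_)
open import Data.Empty using (⊥)
open import Data.Fin using (Fin; toℕ; zero; suc)
open import Data.Fin.Properties using (toℕ-injective)
open import Data.Maybe using (just)
open import Data.Maybe.Properties using (just-injective)
open import Data.Nat
open import Data.Nat.GeneralisedArithmetic using (iterate)
open import Data.Nat.Properties
open import Data.Product using (Σ; ∃; ∃₂; _×_; _,_; proj₁; proj₂)
open import Data.Vec using (Vec; []; _∷_; lookup)
open import Data.Vec.Relation.Binary.Pointwise.Inductive using (Pointwise; []; _∷_)
open import Function using (_∘_; id)
open import Relation.Binary.PropositionalEquality
open import Relation.Nullary using (¬_; yes; no; does; contradiction)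
open import Relation.Nullary.Decidable using (dec-true; dec-false)

private variable
  n m k k′ : ℕ
  O : Oracle

pair : ℕ → ℕ → ℕ
pair zero    b = suc (2 * b)
pair (suc a) b = 2 * pair a b

pair-injective : ∀ {a b a′ b′} → pair a b ≡ pair a′ b′ → a ≡ a′ × b ≡ b′
pair-injective {zero}  {b} {zero}   {b′} eq = refl , *-cancelˡ-≡ b b′ 2 (suc-injective eq)
pair-injective {zero}  {b} {suc a′} {b′} eq = contradiction (sym eq) (even≢odd (pair a′ b′) b)
pair-injective {suc a} {b} {zero}   {b′} eq = contradiction eq (even≢odd (pair a b) b′)
pair-injective {suc a} {b} {suc a′} {b′} eq with pair-injective {a} {b} {a′} (*-cancelˡ-≡ _ _ 2 eq)
... | refl , refl = refl , refl

tag : Code n → ℕ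
tag zer        = 0
tag succ       = 1
tag (proj _)   = 2
tag (comp _ _) = 3
tag (prec _ _) = 4
tag (mu _)     = 5
tag orc        = 6

mutual
  ⌜_⌝ : Code n → ℕ
  ⌜ c ⌝ = pair (tag c) (fields c)

  fields : Code n → ℕ
  fields zer                 = 0
  fields succ                = 0
  fields (proj i)            = toℕ i
  fields (comp {m = m} g hs) = pair m (pair ⌜ g ⌝ ⌜ hs ⌝*)
  fields (prec g h)          = pair ⌜ g ⌝ ⌜ h ⌝
  fields (mu g)              = ⌜ g ⌝
  fields orc                 = 0

  ⌜_⌝* : ∀ {m} → Vec (Code n) m → ℕ
  ⌜ [] ⌝*     = 0
  ⌜ c ∷ cs ⌝* = pair ⌜ c ⌝ ⌜ cs ⌝*

-- Comparing a code with the Shape of another avoids a case split over all pairs of constructors.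
Shape : ℕ → ∀ n → Code n → Set
Shape 0 n       c = c ≡ zer
Shape 1 1       c = c ≡ succ
Shape 2 n       c = ∃ λ i → c ≡ proj i
Shape 3 n       c = ∃ λ m → Σ (Code m) λ g → Σ (Vec (Code n) m) λ hs → c ≡ comp g hs
Shape 4 (suc n) c = ∃₂ λ g h → c ≡ prec g h
Shape 5 n       c = ∃ λ g → c ≡ mu g
Shape 6 2       c = c ≡ orc
Shape _ _       _ = ⊥

shape : (c : Code n) → Shape (tag c) n c
shape zer        = refl
shape succ       = refl
shape (proj i)   = i , refl
shape (comp g hs) = _ , g , hs , refl
shape (prec g h) = g , h , refl
shape (mu g)     = g , refl
shape orc        = refl

mutual
  ⌜⌝-injective : (c c′ : Code n) → ⌜ c ⌝ ≡ ⌜ c′ ⌝ → c ≡ c′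
  ⌜⌝-injective c c′ eq with pair-injective eq
  ... | tag≡ , fields≡ = same-shape c (subst (λ t → Shape t _ c′) (sym tag≡) (shape c′)) fields≡

  same-shape : (c : Code n) {c′ : Code n} → Shape (tag c) n c′ → fields c ≡ fields c′ → c ≡ c′
  same-shape zer         refl                 _  = refl
  same-shape succ        refl                 _  = refl
  same-shape (proj i)    (i′ , refl)          eq = cong proj (toℕ-injective eq)
  same-shape (comp {m = m} g hs) (m′ , g′ , hs′ , refl) eq with pair-injective {m} {a′ = m′} eq
  ... | refl , eq′ with pair-injective eq′
  ... | g≡ , hs≡ = cong₂ comp (⌜⌝-injective g g′ g≡) (⌜⌝*-injective hs hs′ hs≡)
  same-shape (prec g h)  (g′ , h′ , refl)      eq with pair-injective eq
  ... | g≡ , h≡ = cong₂ prec (⌜⌝-injective g g′ g≡) (⌜⌝-injective h h′ h≡)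
  same-shape (mu g)      (g′ , refl)          eq = cong mu (⌜⌝-injective g g′ eq)
  same-shape orc         refl                 _  = refl

  ⌜⌝*-injective : (cs cs′ : Vec (Code n) m) → ⌜ cs ⌝* ≡ ⌜ cs′ ⌝* → cs ≡ cs′
  ⌜⌝*-injective []       []         _  = refl
  ⌜⌝*-injective (c ∷ cs) (c′ ∷ cs′) eq with pair-injective eq
  ... | c≡ , cs≡ = cong₂ _∷_ (⌜⌝-injective c c′ c≡) (⌜⌝*-injective cs cs′ cs≡)

infix 4 _⟨_⟩_⇓_

_⟨_⟩_⇓_ : Code n → Oracle → Vec ℕ n → ℕ → Set
c ⟨ O ⟩ xs ⇓ v = ∃ λ k → eval k O c xs ≡ just v

mono-from-step : {P : ℕ → Set} → (∀ {k} → P k → P (suc k)) → k ≤ k′ → P k → P k′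
mono-from-step {P = P} step = go ∘ ≤⇒≤′
  where
  go : k ≤′ k′ → P k → P k′
  go ≤′-refl         = id
  go (≤′-step k≤′k′) = step ∘ go k≤′k′

module _ {O : Oracle} where

  evalVec-∷ : ∀ k (h : Code n) (hs : Vec (Code n) m) xs {y ys} →
              eval k O h xs ≡ just y → evalVec k O hs xs ≡ just ys →
              evalVec k O (h ∷ hs) xs ≡ just (y ∷ ys)
  evalVec-∷ k h hs xs h↓ hs↓ rewrite h↓ | hs↓ = refl

  eval-comp : ∀ k (g : Code m) (hs : Vec (Code n) m) xs {ys} →
              evalVec k O hs xs ≡ just ys → eval (suc k) O (comp g hs) xs ≡ eval k O g ys
  eval-comp k g hs xs hs↓ rewrite hs↓ = refl

  eval-prec-suc : ∀ k (g : Code n) h y xs {r} →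
                  eval k O (prec g h) (y ∷ xs) ≡ just r →
                  eval (suc k) O (prec g h) (suc y ∷ xs) ≡ eval k O h (y ∷ r ∷ xs)
  eval-prec-suc k g h y xs r↓ rewrite r↓ = refl

  search-found : ∀ k (g : Code (suc n)) xs i →
                 eval k O g (i ∷ xs) ≡ just 0 → search (suc k) O g xs i ≡ just i
  search-found k g xs i g↓ rewrite g↓ = refl

  search-next : ∀ k (g : Code (suc n)) xs i {w} →
                eval k O g (i ∷ xs) ≡ just (suc w) →
                search (suc k) O g xs i ≡ search k O g xs (suc i)
  search-next k g xs i g↓ rewrite g↓ = refl

  mutual
    eval-step : ∀ k (c : Code n) xs {v} → eval k O c xs ≡ just v → eval (suc k) O c xs ≡ just v
    eval-step (suc k) zer         xs            eq = eq
    eval-step (suc k) succ        (_ ∷ [])      eq = eq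
    eval-step (suc k) (proj i)    xs            eq = eq
    eval-step (suc k) (comp g hs) xs            eq with evalVec k O hs xs in hs↓
    ... | just ys = trans (eval-comp (suc k) g hs xs (evalVec-step k hs xs hs↓)) (eval-step k g ys eq)
    eval-step (suc k) (prec g h)  (zero ∷ xs)   eq = eval-step k g xs eq
    eval-step (suc k) (prec g h)  (suc y ∷ xs)  eq with eval k O (prec g h) (y ∷ xs) in r↓
    ... | just r = trans (eval-prec-suc (suc k) g h y xs (eval-step k (prec g h) (y ∷ xs) r↓))
                         (eval-step k h (y ∷ r ∷ xs) eq)
    eval-step (suc k) (mu g)      xs            eq = search-step k g xs 0 eq
    eval-step (suc k) orc         (_ ∷ _ ∷ [])  eq = eq

    evalVec-step : ∀ k (hs : Vec (Code n) m) xs {ys} →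
                   evalVec k O hs xs ≡ just ys → evalVec (suc k) O hs xs ≡ just ys
    evalVec-step k []       xs eq = eq
    evalVec-step k (h ∷ hs) xs eq with eval k O h xs in h↓ | evalVec k O hs xs in hs↓
    ... | just _ | just _ =
      trans (evalVec-∷ (suc k) h hs xs (eval-step k h xs h↓) (evalVec-step k hs xs hs↓)) eq

    search-step : ∀ k (g : Code (suc n)) xs i {v} →
                  search k O g xs i ≡ just v → search (suc k) O g xs i ≡ just v
    search-step (suc k) g xs i eq with eval k O g (i ∷ xs) in g↓
    ... | just zero    = trans (search-found (suc k) g xs i (eval-step k g (i ∷ xs) g↓)) eq
    ... | just (suc _) = trans (search-next (suc k) g xs i (eval-step k g (i ∷ xs) g↓))
                               (search-step k g xs (suc i) eq)

  eval-mono : ∀ (c : Code n) xs {v} →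
              k ≤ k′ → eval k O c xs ≡ just v → eval k′ O c xs ≡ just v
  eval-mono c xs = mono-from-step (eval-step _ c xs)

  evalVec-mono : ∀ (hs : Vec (Code n) m) xs {ys} →
                 k ≤ k′ → evalVec k O hs xs ≡ just ys → evalVec k′ O hs xs ≡ just ys
  evalVec-mono hs xs = mono-from-step (evalVec-step _ hs xs)

  ⇓-deterministic : ∀ {c : Code n} {xs v w} → c ⟨ O ⟩ xs ⇓ v → c ⟨ O ⟩ xs ⇓ w → v ≡ w
  ⇓-deterministic {c = c} {xs} (k , v↓) (k′ , w↓) =
    just-injective (trans (sym (eval-mono c xs (m≤m⊔n k k′) v↓))
                          (eval-mono c xs (m≤n⊔m k k′) w↓))

  ⇓-zer : ∀ {xs : Vec ℕ n} → zer ⟨ O ⟩ xs ⇓ 0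
  ⇓-zer = 1 , refl

  ⇓-proj : ∀ {i : Fin n} {xs} → proj i ⟨ O ⟩ xs ⇓ lookup xs i
  ⇓-proj = 1 , refl

  evalVec-converges : ∀ {hs : Vec (Code n) m} {xs ys} →
                      Pointwise (_⟨ O ⟩ xs ⇓_) hs ys → ∃ λ k → evalVec k O hs xs ≡ just ys
  evalVec-converges [] = 0 , refl
  evalVec-converges {hs = h ∷ hs} {xs} ((k , h↓) ∷ hs⇓) with evalVec-converges hs⇓
  ... | k′ , hs↓ =
    k ⊔ k′ , evalVec-∷ (k ⊔ k′) h hs xs (eval-mono h xs (m≤m⊔n k k′) h↓)
                                        (evalVec-mono hs xs (m≤n⊔m k k′) hs↓)

  ⇓-comp : ∀ {g : Code m} {hs : Vec (Code n) m} {xs ys v} →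
           Pointwise (_⟨ O ⟩ xs ⇓_) hs ys → g ⟨ O ⟩ ys ⇓ v → comp g hs ⟨ O ⟩ xs ⇓ v
  ⇓-comp {g = g} {hs} {xs} {ys} hs⇓ (k′ , g↓) with evalVec-converges hs⇓
  ... | k , hs↓ =
    suc (k ⊔ k′) , trans (eval-comp (k ⊔ k′) g hs xs (evalVec-mono hs xs (m≤m⊔n k k′) hs↓))
                         (eval-mono g ys (m≤n⊔m k k′) g↓)

  ⇓-prec-zero : ∀ {g : Code n} {h xs v} → g ⟨ O ⟩ xs ⇓ v → prec g h ⟨ O ⟩ (zero ∷ xs) ⇓ v
  ⇓-prec-zero (k , g↓) = suc k , g↓

  ⇓-prec-suc : ∀ {g : Code n} {h y xs r v} →
               prec g h ⟨ O ⟩ (y ∷ xs) ⇓ r → h ⟨ O ⟩ (y ∷ r ∷ xs) ⇓ v →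
               prec g h ⟨ O ⟩ (suc y ∷ xs) ⇓ v
  ⇓-prec-suc {g = g} {h} {y} {xs} {r} (k , r↓) (k′ , h↓) =
    suc (k ⊔ k′) ,
    trans (eval-prec-suc (k ⊔ k′) g h y xs (eval-mono (prec g h) (y ∷ xs) (m≤m⊔n k k′) r↓))
          (eval-mono h (y ∷ r ∷ xs) (m≤n⊔m k k′) h↓)

predCode : Code 1
predCode = prec zer (proj zero)

predCode-correct : ∀ y → predCode ⟨ O ⟩ (y ∷ []) ⇓ pred y
predCode-correct zero    = ⇓-prec-zero ⇓-zer
predCode-correct (suc y) = ⇓-prec-suc (predCode-correct y) ⇓-proj

monusCode : Code 2
monusCode = prec (proj zero) (comp predCode (proj (suc zero) ∷ []))

monusCode-correct : ∀ y x → monusCode ⟨ O ⟩ (y ∷ x ∷ []) ⇓ x ∸ y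
monusCode-correct zero    x = ⇓-prec-zero ⇓-proj
monusCode-correct {O = O} (suc y) x = ⇓-prec-suc (monusCode-correct y x)
  (⇓-comp (⇓-proj ∷ [])
          (subst (predCode ⟨ O ⟩ (x ∸ y ∷ []) ⇓_) (pred[m∸n]≡m∸[1+n] x y)
                 (predCode-correct (x ∸ y))))

⌊1+n/2⌋≡n∸⌊n/2⌋ : ∀ n → ⌊ suc n /2⌋ ≡ n ∸ ⌊ n /2⌋
⌊1+n/2⌋≡n∸⌊n/2⌋ n = begin
  ⌈ n /2⌉                      ≡⟨ sym (m+n∸m≡n ⌊ n /2⌋ ⌈ n /2⌉) ⟩
  ⌊ n /2⌋ + ⌈ n /2⌉ ∸ ⌊ n /2⌋  ≡⟨ cong (_∸ ⌊ n /2⌋) (⌊n/2⌋+⌈n/2⌉≡n n) ⟩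
  n ∸ ⌊ n /2⌋                  ∎
  where open ≡-Reasoning

halfCode : Code 1
halfCode = prec zer (comp monusCode (proj (suc zero) ∷ proj zero ∷ []))

halfCode-correct : ∀ x → halfCode ⟨ O ⟩ (x ∷ []) ⇓ ⌊ x /2⌋
halfCode-correct zero    = ⇓-prec-zero ⇓-zer
halfCode-correct {O = O} (suc y) = ⇓-prec-suc (halfCode-correct y)
  (⇓-comp (⇓-proj ∷ ⇓-proj ∷ [])
          (subst (monusCode ⟨ O ⟩ (⌊ y /2⌋ ∷ y ∷ []) ⇓_) (sym (⌊1+n/2⌋≡n∸⌊n/2⌋ y))
                 (monusCode-correct ⌊ y /2⌋ y)))

StrictlyIncreasing : (ℕ → ℕ) → Set
StrictlyIncreasing p = ∀ n → p n < p (suc n)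

module Increasing {p : ℕ → ℕ} (p-inc : StrictlyIncreasing p) where

  mono-≤ : m ≤ n → p m ≤ p n
  mono-≤ {m} m≤n = mono-from-step {P = λ k → p m ≤ p k} step m≤n ≤-refl
    where
    step : ∀ {k} → p m ≤ p k → p m ≤ p (suc k)
    step {k} p[m]≤p[k] = ≤-trans p[m]≤p[k] (<⇒≤ (p-inc k))

  mono-< : m < n → p m < p n
  mono-< {m} m<n = <-≤-trans (p-inc m) (mono-≤ m<n)

  cancel-≤ : p m ≤ p n → m ≤ n
  cancel-≤ p[m]≤p[n] = ≮⇒≥ (λ n<m → <⇒≱ (mono-< n<m) p[m]≤p[n])

  cancel-< : p m < p n → m < n
  cancel-< p[m]<p[n] = ≰⇒> (λ n≤m → <⇒≱ p[m]<p[n] (mono-≤ n≤m))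

  n≤p[n] : ∀ n → n ≤ p n
  n≤p[n] zero    = z≤n
  n≤p[n] (suc n) = ≤-<-trans (n≤p[n] n) (p-inc n)

  no-value-between : ∀ {x} → p n < x → x < p (suc n) → p m ≢ x
  no-value-between p[n]<x x<p[1+n] refl = <⇒≱ (cancel-< p[n]<x) (s≤s⁻¹ (cancel-< x<p[1+n]))

module _ {p q : ℕ → ℕ} (p-inc : StrictlyIncreasing p) (q-inc : StrictlyIncreasing q) where
  open Increasing p-inc

  enumeration-≤ : (∀ n → ∃ λ k → p k ≡ q n) → ∀ n → p n ≤ q n
  enumeration-≤ q⊆p n = subst (p n ≤_) (p[index]≡q n) (mono-≤ (Increasing.n≤p[n] index-increasing n))
    where
    index : ℕ → ℕ
    index = proj₁ ∘ q⊆p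

    p[index]≡q : ∀ n → p (index n) ≡ q n
    p[index]≡q = proj₂ ∘ q⊆p

    index-increasing : StrictlyIncreasing index
    index-increasing n = cancel-< (subst₂ _<_ (sym (p[index]≡q n)) (sym (p[index]≡q (suc n))) (q-inc n))

principal-unique : ∀ {C p q} → IsPrincipal C p → IsPrincipal C q → ∀ n → p n ≡ q n
principal-unique (p-inc , p-range) (q-inc , q-range) n =
  ≤-antisym (enumeration-≤ p-inc q-inc (λ n → proj₁ (p-range _) (proj₂ (q-range _) n refl)) n)
            (enumeration-≤ q-inc p-inc (λ n → proj₁ (q-range _) (proj₂ (p-range _) n refl)) n)

principal⇒infinite : ∀ {C p} → IsPrincipal C p → Infinite C
principal⇒infinite {p = p} (p-inc , p-range) n =
  p n , Increasing.n≤p[n] p-inc n , proj₂ (p-range (p n)) n refl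

record LeastFrom (C : NSet) (m r : ℕ) : Set where
  field
    above  : m ≤ r
    member : C r ≡ true
    least  : ∀ z → m ≤ z → C z ≡ true → r ≤ z
open LeastFrom

first-from : NSet → ℕ → ℕ → ℕ
first-from C zero    m = m
first-from C (suc d) m = if C m then m else first-from C d (suc m)

least-from-self : ∀ {C m} → C m ≡ true → LeastFrom C m m
least-from-self C[m] = record { above = ≤-refl ; member = C[m] ; least = λ _ m≤z _ → m≤z }

first-from-least : ∀ C d m → C (d + m) ≡ true → LeastFrom C m (first-from C d m)
first-from-least C zero    m C[m] = least-from-self C[m]
first-from-least C (suc d) m C[d+m] with C m in C[m]
... | true  = least-from-self C[m]
... | false = record
  { above  = <⇒≤ (above from-1+m)
  ; member = member from-1+m
  ; least  = λ z m≤z C[z] → least from-1+m z (≤∧≢⇒< m≤z (m≢z C[z])) C[z]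
  }
  where
  from-1+m : LeastFrom C (suc m) (first-from C d (suc m))
  from-1+m = first-from-least C d (suc m) (subst (λ x → C x ≡ true) (sym (+-suc d m)) C[d+m])

  m≢z : ∀ {z} → C z ≡ true → m ≢ z
  m≢z C[z] refl with () ← trans (sym C[m]) C[z]

module Enumeration (C : NSet) (C-inf : Infinite C) where

  least-from : ℕ → ℕ
  least-from m = first-from C (proj₁ (C-inf m) ∸ m) m

  least-from-least : ∀ m → LeastFrom C m (least-from m)
  least-from-least m with C-inf m
  ... | w , m≤w , C[w] =
    first-from-least C (w ∸ m) m (subst (λ x → C x ≡ true) (sym (m∸n+n≡m m≤w)) C[w])

  enum : ℕ → ℕ
  enum zero    = least-from 0
  enum (suc n) = least-from (suc (enum n))

  enum-increasing : StrictlyIncreasing enum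
  enum-increasing n = above (least-from-least (suc (enum n)))

  enum-member : ∀ n → C (enum n) ≡ true
  enum-member zero    = member (least-from-least 0)
  enum-member (suc n) = member (least-from-least (suc (enum n)))

  enum-onto-below : ∀ n {x} → C x ≡ true → x ≤ enum n → ∃ λ j → enum j ≡ x
  enum-onto-below zero {x} C[x] x≤e = 0 , ≤-antisym (least (least-from-least 0) x z≤n C[x]) x≤e
  enum-onto-below (suc n) {x} C[x] x≤e with x ≤? enum n
  ... | yes x≤e′ = enum-onto-below n C[x] x≤e′
  ... | no  x≰e′ =
    suc n , ≤-antisym (least (least-from-least (suc (enum n))) x (≰⇒> x≰e′) C[x]) x≤e

  enum-principal : IsPrincipal C enum
  enum-principal = enum-increasing , λ x →
    (λ C[x] → enum-onto-below x C[x] (Increasing.n≤p[n] enum-increasing x)) ,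
    (λ n enum[n]≡x → subst (λ y → C y ≡ true) enum[n]≡x (enum-member n))

principal-exists : ∀ {C} → Infinite C → ∃ (IsPrincipal C)
principal-exists {C} C-inf = enum , enum-principal
  where open Enumeration C C-inf

MajorReduces : Code 1 → NSet → Set
MajorReduces Φ B = ∀ p → IsPrincipal B p → ∀ (f : ℕ → ℕ) → (∀ n → p n ≤ f n) →
                   ∀ x → Φ ⟨ graph f ⟩ x ↓ (if B x then 1 else 0)

indicator-injective : ∀ {b b′ : Bool} → (if b then 1 else 0) ≡ (if b′ then 1 else 0) → b ≡ b′
indicator-injective {true}  {true}  _ = refl
indicator-injective {false} {false} _ = refl

majorReduces-unique : ∀ {Φ B C} → Infinite B → Infinite C → MajorReduces Φ B → MajorReduces Φ C →
                      ∀ x → B x ≡ C x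
majorReduces-unique B-inf C-inf Φ-B Φ-C x with principal-exists B-inf | principal-exists C-inf
... | p , p-principal | q , q-principal = indicator-injective (⇓-deterministic
  (Φ-B p p-principal (λ n → p n ⊔ q n) (λ n → m≤m⊔n (p n) (q n)) x)
  (Φ-C q q-principal (λ n → p n ⊔ q n) (λ n → m≤n⊔m (p n) (q n)) x))

halving-retraceable : ∀ {A a} → IsPrincipal A a → a 0 ≡ 0 → (∀ n → ⌊ a (suc n) /2⌋ ≡ a n) →
                      Retraceable A
halving-retraceable {A} {a} a-principal a[0]≡0 halves =
  principal⇒infinite a-principal , halfCode , λ p p-principal →
    let p≡a = principal-unique p-principal a-principal in
    subst (halfCode · p 0 ↓_) (retracts-0 p p≡a) (halfCode-correct (p 0)) ,
    λ n → subst (halfCode · p (suc n) ↓_) (retracts p p≡a n) (halfCode-correct (p (suc n)))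
  where
  open ≡-Reasoning

  retracts-0 : ∀ p → (∀ n → p n ≡ a n) → ⌊ p 0 /2⌋ ≡ p 0
  retracts-0 p p≡a = begin
    ⌊ p 0 /2⌋ ≡⟨ cong ⌊_/2⌋ p[0]≡0 ⟩
    0         ≡⟨ p[0]≡0 ⟨
    p 0       ∎
    where
    p[0]≡0 : p 0 ≡ 0
    p[0]≡0 = trans (p≡a 0) a[0]≡0

  retracts : ∀ p → (∀ n → p n ≡ a n) → ∀ n → ⌊ p (suc n) /2⌋ ≡ p n
  retracts p p≡a n = begin
    ⌊ p (suc n) /2⌋ ≡⟨ cong ⌊_/2⌋ (p≡a (suc n)) ⟩
    ⌊ a (suc n) /2⌋ ≡⟨ halves n ⟩
    a n             ≡⟨ p≡a n ⟨
    p n             ∎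

infix 4 _⊑_

_⊑_ : ℕ → ℕ → Set
z ⊑ c = ∃ λ k → iterate ⌊_/2⌋ c k ≡ z

⌊[b+2n]/2⌋≡n : ∀ b n → ⌊ bit b + (n + n) /2⌋ ≡ n
⌊[b+2n]/2⌋≡n false n = sym (n≡⌊n+n/2⌋ n)
⌊[b+2n]/2⌋≡n true  n = +-cancelˡ-≡ n _ _
  (trans (cong (_+ ⌈ n + n /2⌉) (n≡⌊n+n/2⌋ n)) (⌊n/2⌋+⌈n/2⌉≡n (n + n)))

module Construction (em : ExcludedMiddle 0ℓ) where

  ConeMet : ℕ → ℕ → Set
  ConeMet e z = Σ (Code 1) λ Φ → ⌜ Φ ⌝ ≡ e ×
                Σ NSet λ C → Infinite C × MajorReduces Φ C × ∃ λ c → C c ≡ true × z ⊑ c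

  turn : ℕ → ℕ → Bool
  turn e y = does (em {ConeMet e (y + y)})

  child : ℕ → ℕ → ℕ
  child e y = bit (turn e y) + (y + y)

  a : ℕ → ℕ
  a zero          = 0
  a (suc zero)    = 1
  a (suc (suc e)) = child e (a (suc e))

  A : NSet
  A x = does (em {∃ λ n → a n ≡ x})

  A-member : ∀ {x} → A x ≡ true → ∃ λ n → a n ≡ x
  A-member {x} A[x] with em {∃ λ n → a n ≡ x}
  ... | yes a[n]≡x = a[n]≡x

  child-yes : ∀ e y → ConeMet e (y + y) → child e y ≡ suc (y + y)
  child-yes e y met = cong (λ b → bit b + (y + y)) (dec-true em met)

  child-no : ∀ e y → ¬ ConeMet e (y + y) → child e y ≡ y + y
  child-no e y ¬met = cong (λ b → bit b + (y + y)) (dec-false em ¬met)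

  ⌊a[1+n]/2⌋≡a[n] : ∀ n → ⌊ a (suc n) /2⌋ ≡ a n
  ⌊a[1+n]/2⌋≡a[n] zero    = refl
  ⌊a[1+n]/2⌋≡a[n] (suc e) = ⌊[b+2n]/2⌋≡n (turn e (a (suc e))) (a (suc e))

  mutual
    a-increasing : StrictlyIncreasing a
    a-increasing zero    = s≤s z≤n
    a-increasing (suc e) = <-≤-trans (m<m+n y (a-positive e)) (m≤n+m (y + y) (bit (turn e y)))
      where y = a (suc e)

    a-positive : ∀ e → 0 < a (suc e)
    a-positive e = ≤-<-trans z≤n (a-increasing e)

  open Increasing a-increasing

  a-principal : IsPrincipal A a
  a-principal = a-increasing , λ x →
    A-member , λ n a[n]≡x → subst (λ y → A y ≡ true) a[n]≡x (dec-true em (n , refl))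

  halvings : ∀ m k → iterate ⌊_/2⌋ (a m) k ≡ a (m ∸ k)
  halvings m       zero    = refl
  halvings zero    (suc k) = trans (halvings 0 k) (cong a (0∸n≡0 k))
  halvings (suc m) (suc k) = trans (cong (λ x → iterate ⌊_/2⌋ x k) (⌊a[1+n]/2⌋≡a[n] m)) (halvings m k)

  met-cone-avoided : ∀ {e} → ConeMet e (a (suc e) + a (suc e)) → ∀ m → ¬ (a (suc e) + a (suc e) ⊑ a m)
  met-cone-avoided {e} met m (k , halving≡) =
    no-value-between {n = suc e} {m = m ∸ k} (m<m+n y (a-positive e))
                                             (subst (y + y <_) (sym (child-yes e y met)) ≤-refl)
                                             (trans (sym (halvings m k)) halving≡)
    where y = a (suc e)

  subset-meets-cones : ∀ {B} → B ⊆ A → Infinite B → ∀ n → ∃ λ c → B c ≡ true × a n ⊑ c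
  subset-meets-cones B⊆A B-inf n with B-inf (a n)
  ... | c , a[n]≤c , B[c] with A-member (B⊆A c B[c])
  ... | m , refl = a m , B[c] , m ∸ n , trans (halvings m (m ∸ n)) (cong a (m∸[m∸n]≡n n≤m))
    where
    n≤m : n ≤ m
    n≤m = cancel-≤ a[n]≤c

  no-subset-majorreducible : ∀ B → B ⊆ A → Infinite B → ¬ UniformlyMajorreducible B
  no-subset-majorreducible B B⊆A B-inf (_ , Φ , Φ-B)
    with em {ConeMet ⌜ Φ ⌝ (a (suc ⌜ Φ ⌝) + a (suc ⌜ Φ ⌝))}
  ... | yes met@(Φ′ , ⌜Φ′⌝≡⌜Φ⌝ , C , C-inf , Φ′-C , c , C[c] , cone)
    with ⌜⌝-injective Φ′ Φ ⌜Φ′⌝≡⌜Φ⌝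
  ...   | refl with A-member (B⊆A c (trans (majorReduces-unique B-inf C-inf Φ-B Φ′-C c) C[c]))
  ...     | m , refl = met-cone-avoided met m cone
  no-subset-majorreducible B B⊆A B-inf (_ , Φ , Φ-B) | no ¬met
    with subset-meets-cones B⊆A B-inf (suc (suc ⌜ Φ ⌝))
  ... | c , B[c] , cone =
    ¬met (Φ , refl , B , B-inf , Φ-B , c , B[c] ,
          subst (_⊑ c) (child-no ⌜ Φ ⌝ (a (suc ⌜ Φ ⌝)) ¬met) cone)

  retraceable : Retraceable A
  retraceable = halving-retraceable a-principal refl ⌊a[1+n]/2⌋≡a[n]

theorem5p12 : ExcludedMiddle 0ℓ →
    Σ NSet λ A → Retraceable A ×
      (∀ (B : NSet) → B ⊆ A → Infinite B → ¬ UniformlyMajorreducible B)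
theorem5p12 em = A , retraceable , no-subset-majorreducible
  where open Construction em
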